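{- Let $P=\operatorname{conv}(0,v_1,\dots,v_d)\subset\mathbb{R}^d$ be an empty lattice $d$-simplex of lattice width $w$ and let $m\ge2$ be an integer. For $i\in[d]$ and $j\in[m]$ let $v_i^{(j)}\in\mathbb{R}^{md}=(\mathbb{R}^d)^m$ be the vector having $v_i$ in the $j$-th block of $d$ coordinates and $0$ elsewhere, and define \[w_i^{(j)}:=(m-2)v_i^{(j)}+v_{i+1}^{(j+1)}\in\mathbb{R}^{md},\] with $i$ taken modulo $d$ (in $[d]$) and $j$ taken modulo $m$ (in $[m]$). Let \[P_m:=\operatorname{conv}\left(\{0\}\cup\{w_i^{(j)}:(i,j)\in[d]\times[m]\}\right).\] Then (1) the lattice width of $P_m$ with respect to $\mathbb{Z}^{md}$ is at least $(m-3)w$; and (2) $P_m$ is empty, i.e., the only points of $\mathbb{Z}^{md}$ in $P_m$ are $0$ and the points $w_i^{(j)}$.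
   Context: A lattice simplex (vertices in $\mathbb{Z}^d$) is empty if its only integer points are its vertices. The lattice width of a convex body $K\subset\mathbb{R}^n$ is $\inf_{f\in(\mathbb{Z}^n)^*\setminus\{0\}}(\max_K f-\min_K f)$. -}

module Defs where

open import Data.Nat as ℕ using (ℕ; zero; suc)
open import Data.Nat.DivMod using (_%_; m%n<n)
open import Data.Integer as ℤ using (ℤ; +_)
open import Data.Rational as ℚ using (ℚ; _/_; 0ℚ; 1ℚ)
open import Data.Fin using (Fin; zero; suc; toℕ; fromℕ<; remQuot; _≟_)
open import Data.Product using (Σ; ∃; _×_; _,_)
open import Relation.Binary.PropositionalEquality using (_≡_; _≢_)
open import Relation.Nullary using (yes; no)

Ptℚ : ℕ → Set
Ptℚ n = Fin n → ℚ

Ptℤ : ℕ → Set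
Ptℤ n = Fin n → ℤ

toℚ : ℤ → ℚ
toℚ z = z / 1

embed : ∀ {n} → Ptℤ n → Ptℚ n
embed z i = toℚ (z i)

Σℚ : ∀ k → (Fin k → ℚ) → ℚ
Σℚ zero    f = 0ℚ
Σℚ (suc k) f = f zero ℚ.+ Σℚ k (λ i → f (suc i))

⟪_,_⟫ : ∀ {n} → Ptℤ n → Ptℚ n → ℚ
⟪_,_⟫ {n} f x = Σℚ n (λ c → toℚ (f c) ℚ.* x c)

InConv : ∀ {n k} → (Fin k → Ptℤ n) → Ptℚ n → Set
InConv {n} {k} pts x =
  Σ (Fin k → ℚ) λ λs →
    (∀ i → 0ℚ ℚ.≤ λs i) × (Σℚ k λs ≡ 1ℚ)
    × (∀ c → x c ≡ Σℚ k (λ i → λs i ℚ.* toℚ (pts i c)))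

NonZeroFunctional : ∀ {n} → Ptℤ n → Set
NonZeroFunctional {n} f = ∃ λ (c : Fin n) → f c ≢ + 0

-- lattice width of conv(pts) is ≥ b:  for every nonzero integer functional f,
-- max_K f - min_K f ≥ b (the max/min over the polytope K are attained)
LatticeWidth≥ : ∀ {n k} → (Fin k → Ptℤ n) → ℚ → Set
LatticeWidth≥ pts b =
  ∀ f → NonZeroFunctional f →
    ∃ λ x → ∃ λ y → InConv pts x × InConv pts y × (b ℚ.≤ (⟪ f , x ⟫ ℚ.- ⟪ f , y ⟫))

LatticeWidth≡ : ∀ {n k} → (Fin k → Ptℤ n) → ℚ → Set
LatticeWidth≡ pts b =
  LatticeWidth≥ pts b ×
  (∃ λ f → NonZeroFunctional f ×
     (∀ x y → InConv pts x → InConv pts y → (⟪ f , x ⟫ ℚ.- ⟪ f , y ⟫) ℚ.≤ b))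

EmptyPolytope : ∀ {n k} → (Fin k → Ptℤ n) → Set
EmptyPolytope {n} {k} pts =
  ∀ (z : Ptℤ n) → InConv pts (embed z) → ∃ λ (i : Fin k) → ∀ c → z c ≡ pts i c

simplexVerts : ∀ {d} → (Fin d → Ptℤ d) → Fin (suc d) → Ptℤ d
simplexVerts v zero    = λ _ → + 0
simplexVerts v (suc i) = v i

-- v_1,...,v_d linearly independent over ℚ (i.e. P is a d-simplex)
LinIndep : ∀ {d} → (Fin d → Ptℤ d) → Set
LinIndep {d} v =
  ∀ (a : Fin d → ℚ) → (∀ c → Σℚ d (λ i → a i ℚ.* toℚ (v i c)) ≡ 0ℚ) → ∀ i → a i ≡ 0ℚ

cycSuc : ∀ {n} → Fin n → Fin n
cycSuc {suc n} i = fromℕ< (m%n<n (suc (toℕ i)) (suc n))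

δ : ∀ {m} → Fin m → Fin m → ℤ
δ a b with a ≟ b
... | yes _ = + 1
... | no  _ = + 0

-- w_i^{(j)} ∈ ℤ^{md}, coordinates indexed by Fin (m * d), coordinate c lying in
-- block j' (of d coordinates) at position i' where (j' , i') = remQuot d c.
wVec : ∀ m {d} → (Fin d → Ptℤ d) → Fin d → Fin m → Ptℤ (m ℕ.* d)
wVec m {d} v i j c with remQuot {m} d c
... | (j' , i') =
  ((+ m ℤ.- + 2) ℤ.* (δ j' j ℤ.* v i i'))
  ℤ.+ (δ j' (cycSuc j) ℤ.* v (cycSuc i) i')

PmVerts : ∀ m {d} → (Fin d → Ptℤ d) → Fin (suc (m ℕ.* d)) → Ptℤ (m ℕ.* d)
PmVerts m v zero    = λ _ → + 0
PmVerts m {d} v (suc k) with remQuot {m} d k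
... | (j , i) = wVec m v i j

-- Write a point of P_m as 0 weighted by λ₀ plus Σ λ_{j,i} w_i^{(j)}.  Its j-th block of d
-- coordinates is Σ_i c_{j,i} v_i with c_{j,i} = (m − 2) λ_{j,i} + λ_{j−1,i−1} ≥ 0.
--
-- A nonzero integer functional f has blocks f_j, one of them nonzero.  Let R_j be the
-- range of f_j over P, so R_j ≥ w whenever f_j ≠ 0, and pick j maximising R_j.  Lifting the
-- vertices of P where f_j is extremal to block j (0 ↦ 0, v_i ↦ w_i^{(j)}) gives two vertices of
-- P_m on which f differs by (m − 2) R_j plus a difference of values of f_{j+1}, which is at
-- least −R_{j+1} ≥ −R_j.  Hence the range of f on P_m is at least (m − 3) R_j ≥ (m − 3) w.
--
-- Let z be a lattice point of P_m.  If some weight is 1, z is a vertex.  Otherwise: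
-- Σ_{j,i} c_{j,i} = (m − 1) Σ λ ≤ m − 1 < m, so some block has Σ_i c_{j,i} < 1.  That block is
-- then a lattice point of P, hence a vertex of P since P is empty, and linear independence
-- forces its coefficients to be 0 (a unit vector would sum to 1); in particular λ_{j−1,·} = 0.
-- Whenever λ_{j,·} = 0, block j has coefficients λ_{j−1,i−1} summing to at most 1, so again
-- they are 0 or a unit vector, and the latter is excluded because no weight is 1.  Going
-- around the cycle of blocks, all λ_{j,i} vanish, so λ₀ = 1, a contradiction.

module Submission where

open import Defs
open import Algebra.Bundles using (CommutativeRing)
open import Data.Empty using (⊥; ⊥-elim)
open import Data.Fin as Fin
  using (Fin; zero; suc; toℕ; fromℕ; inject₁; lower₁; combine; remQuot; punchIn; _↑ˡ_; _↑ʳ_)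
import Data.Fin.Properties as FinP
open import Data.Fin.Induction using (>-weakInduction)
open import Data.Fin.Permutation using (Permutation′; permutation; _⟨$⟩ʳ_)
open import Data.Integer as ℤ using (ℤ; +_; -[1+_])
import Data.Integer.Properties as ℤP
import Data.Nat.Properties as ℕP
open import Data.Nat as ℕ using (ℕ; zero; suc)
import Data.Nat.Coprimality as Coprimality
open import Data.Nat.DivMod using (m%n<n; n%n≡0; m<n⇒m%n≡m)
open import Data.Product using (∃; _×_; _,_; proj₁; proj₂; map)
open import Data.Rational as ℚ using (ℚ; mkℚ; 0ℚ; 1ℚ; _+_; _*_; _-_; -_; _≤_; _<_; _/_)
import Data.Rational.Properties as ℚP
open import Data.Rational.Solver using (module +-*-Solver)
open import Data.Sum using (_⊎_; inj₁; inj₂; [_,_]′)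
open import Data.Vec.Functional using (_∷_)
open import Function using (_∘_)
open import Relation.Nullary using (¬_; Dec; yes; no)
open import Relation.Unary using (Pred)
open import Relation.Binary.PropositionalEquality
open import Algebra.Properties.Semiring.Sum (CommutativeRing.semiring ℚP.+-*-commutativeRing)
  using (sum; sum-cong-≗; ∑-distrib-+; *-distribˡ-sum; sum-replicate-zero; sum-remove; sum-permute)
open import Algebra.Properties.Group ℚP.+-0-group using (identityʳ-unique; x∙y⁻¹≈ε⇒x≈y)
open +-*-Solver

toℚ≡mkℚ : ∀ z → toℚ z ≡ mkℚ z 0 (Coprimality.sym (Coprimality.1-coprimeTo ℤ.∣ z ∣))
toℚ≡mkℚ (+ n)    = ℚP.normalize-coprime (Coprimality.sym (Coprimality.1-coprimeTo n))
toℚ≡mkℚ -[1+ n ] = cong -_ (ℚP.normalize-coprime (Coprimality.sym (Coprimality.1-coprimeTo (suc n))))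

toℚ-+ : ∀ a b → toℚ (a ℤ.+ b) ≡ toℚ a + toℚ b
toℚ-+ a b rewrite toℚ≡mkℚ a | toℚ≡mkℚ b =
  cong (_/ 1) (sym (cong₂ ℤ._+_ (ℤP.*-identityʳ a) (ℤP.*-identityʳ b)))

toℚ-* : ∀ a b → toℚ (a ℤ.* b) ≡ toℚ a * toℚ b
toℚ-* a b rewrite toℚ≡mkℚ a | toℚ≡mkℚ b = refl

toℚ-injective : ∀ {a b} → toℚ a ≡ toℚ b → a ≡ b
toℚ-injective {a} {b} eq = cong ℚ.numerator (trans (sym (toℚ≡mkℚ a)) (trans eq (toℚ≡mkℚ b)))

toℚ-mono-≤ : ∀ {a b} → a ℤ.≤ b → toℚ a ≤ toℚ b
toℚ-mono-≤ {a} {b} a≤b rewrite toℚ≡mkℚ a | toℚ≡mkℚ b =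
  ℚ.*≤* (subst₂ ℤ._≤_ (sym (ℤP.*-identityʳ a)) (sym (ℤP.*-identityʳ b)) a≤b)

toℚ-mono-< : ∀ {a b} → a ℤ.< b → toℚ a < toℚ b
toℚ-mono-< {a} {b} a<b rewrite toℚ≡mkℚ a | toℚ≡mkℚ b =
  ℚ.*<* (subst₂ ℤ._<_ (sym (ℤP.*-identityʳ a)) (sym (ℤP.*-identityʳ b)) a<b)

0≤toℚ+ : ∀ n → 0ℚ ≤ toℚ (+ n)
0≤toℚ+ n = toℚ-mono-≤ {+ 0} {+ n} (ℤ.+≤+ ℕ.z≤n)

p≤p+q : ∀ {p q} → 0ℚ ≤ q → p ≤ p + q
p≤p+q {p} {q} 0≤q = subst (_≤ p + q) (ℚP.+-identityʳ p) (ℚP.+-monoʳ-≤ p 0≤q)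

q≤p+q : ∀ {p q} → 0ℚ ≤ p → q ≤ p + q
q≤p+q {p} {q} 0≤p = subst (q ≤_) (ℚP.+-comm q p) (p≤p+q 0≤p)

0≤p*q : ∀ {p q} → 0ℚ ≤ p → 0ℚ ≤ q → 0ℚ ≤ p * q
0≤p*q {p} {q} 0≤p 0≤q =
  subst (_≤ p * q) (ℚP.*-zeroʳ p) (ℚP.*-monoˡ-≤-nonNeg p {{ℚ.nonNegative 0≤p}} 0≤q)

-‿mono-≤ : ∀ {a b c e} → a ≤ b → e ≤ c → a - c ≤ b - e
-‿mono-≤ a≤b e≤c = ℚP.+-mono-≤ a≤b (ℚP.neg-antimono-≤ e≤c)

Σℚ≡sum : ∀ n (f : Fin n → ℚ) → Σℚ n f ≡ sum f
Σℚ≡sum zero    f = refl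
Σℚ≡sum (suc n) f = cong (_+_ (f zero)) (Σℚ≡sum n (f ∘ suc))

Σℚ-cong : ∀ n {f g : Fin n → ℚ} → (∀ i → f i ≡ g i) → Σℚ n f ≡ Σℚ n g
Σℚ-cong n {f} {g} f≗g = trans (Σℚ≡sum n f) (trans (sum-cong-≗ f≗g) (sym (Σℚ≡sum n g)))

Σℚ-+ : ∀ n (f g : Fin n → ℚ) → Σℚ n (λ i → f i + g i) ≡ Σℚ n f + Σℚ n g
Σℚ-+ n f g =
  trans (Σℚ≡sum n _) (trans (∑-distrib-+ f g) (sym (cong₂ _+_ (Σℚ≡sum n f) (Σℚ≡sum n g))))

Σℚ-*ˡ : ∀ n a (f : Fin n → ℚ) → Σℚ n (λ i → a * f i) ≡ a * Σℚ n f
Σℚ-*ˡ n a f = trans (Σℚ≡sum n _) (sym (trans (cong (a *_) (Σℚ≡sum n f)) (*-distribˡ-sum a f)))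

Σℚ-linear : ∀ n a b (f g : Fin n → ℚ) →
  Σℚ n (λ i → a * f i + b * g i) ≡ a * Σℚ n f + b * Σℚ n g
Σℚ-linear n a b f g =
  trans (Σℚ-+ n (λ i → a * f i) (λ i → b * g i)) (cong₂ _+_ (Σℚ-*ˡ n a f) (Σℚ-*ˡ n b g))

Σℚ-0 : ∀ n → Σℚ n (λ _ → 0ℚ) ≡ 0ℚ
Σℚ-0 n = trans (Σℚ≡sum n _) (sum-replicate-zero n)

Σℚ-remove : ∀ n (f : Fin (suc n) → ℚ) a → Σℚ (suc n) f ≡ f a + Σℚ n (f ∘ punchIn a)
Σℚ-remove n f a =
  trans (Σℚ≡sum (suc n) f) (trans (sum-remove f) (cong (_+_ (f a)) (sym (Σℚ≡sum n _))))

Σℚ-permute : ∀ n (f : Fin n → ℚ) (π : Permutation′ n) →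
  Σℚ n (λ i → f (π ⟨$⟩ʳ i)) ≡ Σℚ n f
Σℚ-permute n f π = trans (Σℚ≡sum n _) (trans (sym (sum-permute f π)) (sym (Σℚ≡sum n f)))

Σℚ-comm : ∀ m n (f : Fin m → Fin n → ℚ) →
  Σℚ m (λ i → Σℚ n (f i)) ≡ Σℚ n (λ j → Σℚ m (λ i → f i j))
Σℚ-comm zero    n f = sym (Σℚ-0 n)
Σℚ-comm (suc m) n f = trans (cong (_+_ (Σℚ n (f zero))) (Σℚ-comm m n (f ∘ suc)))
  (sym (Σℚ-+ n (f zero) (λ j → Σℚ m (λ i → f (suc i) j))))

Σℚ-split : ∀ a b (g : Fin (a ℕ.+ b) → ℚ) →
  Σℚ (a ℕ.+ b) g ≡ Σℚ a (λ i → g (i ↑ˡ b)) + Σℚ b (λ i → g (a ↑ʳ i))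
Σℚ-split zero    b g = sym (ℚP.+-identityˡ _)
Σℚ-split (suc a) b g =
  trans (cong (_+_ (g zero)) (Σℚ-split a b (g ∘ suc))) (sym (ℚP.+-assoc (g zero) _ _))

Σℚ-combine : ∀ m d (g : Fin (m ℕ.* d) → ℚ) →
  Σℚ (m ℕ.* d) g ≡ Σℚ m (λ j → Σℚ d (λ i → g (combine j i)))
Σℚ-combine zero    d g = refl
Σℚ-combine (suc m) d g = trans (Σℚ-split d (m ℕ.* d) g)
  (cong (_+_ (Σℚ d (λ i → g (i ↑ˡ (m ℕ.* d))))) (Σℚ-combine m d (λ c → g (d ↑ʳ c))))

Σℚ-supported : ∀ n (f : Fin (suc n) → ℚ) a →
  (∀ j → f (punchIn a j) ≡ 0ℚ) → Σℚ (suc n) f ≡ f a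
Σℚ-supported n f a off-a = trans (Σℚ-remove n f a)
  (trans (cong (_+_ (f a)) (trans (Σℚ-cong n off-a) (Σℚ-0 n))) (ℚP.+-identityʳ (f a)))

Σℚ-mono-≤ : ∀ n {f g : Fin n → ℚ} → (∀ i → f i ≤ g i) → Σℚ n f ≤ Σℚ n g
Σℚ-mono-≤ zero    f≤g = ℚP.≤-refl
Σℚ-mono-≤ (suc n) f≤g = ℚP.+-mono-≤ (f≤g zero) (Σℚ-mono-≤ n (f≤g ∘ suc))

Σℚ-nonNeg : ∀ n {f : Fin n → ℚ} → (∀ i → 0ℚ ≤ f i) → 0ℚ ≤ Σℚ n f
Σℚ-nonNeg n {f} 0≤f = subst (_≤ Σℚ n f) (Σℚ-0 n) (Σℚ-mono-≤ n 0≤f)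

term≤Σℚ : ∀ n {f : Fin n → ℚ} → (∀ i → 0ℚ ≤ f i) → ∀ a → f a ≤ Σℚ n f
term≤Σℚ (suc n) {f} 0≤f a =
  subst (f a ≤_) (sym (Σℚ-remove n f a)) (p≤p+q (Σℚ-nonNeg n (0≤f ∘ punchIn a)))

Σℚ≡0⇒≡0 : ∀ n {f : Fin n → ℚ} → (∀ i → 0ℚ ≤ f i) →
  Σℚ n f ≡ 0ℚ → ∀ i → f i ≡ 0ℚ
Σℚ≡0⇒≡0 n 0≤f Σ≡0 i = ℚP.≤-antisym (subst (_ ≤_) Σ≡0 (term≤Σℚ n 0≤f i)) (0≤f i)

Σℚ-1 : ∀ n → Σℚ n (λ _ → 1ℚ) ≡ toℚ (+ n)
Σℚ-1 zero    = refl
Σℚ-1 (suc n) = trans (cong (_+_ 1ℚ) (Σℚ-1 n)) (sym (toℚ-+ (+ 1) (+ n)))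

Σℚ<n⇒∃<1 : ∀ n (f : Fin n → ℚ) → Σℚ n f < toℚ (+ n) → ∃ λ i → f i < 1ℚ
Σℚ<n⇒∃<1 n f Σ<n with FinP.any? (λ i → f i ℚP.<? 1ℚ)
... | yes found = found
... | no  none  = ⊥-elim (ℚP.<-irrefl refl (ℚP.<-≤-trans Σ<n n≤Σ))
  where
  n≤Σ : toℚ (+ n) ≤ Σℚ n f
  n≤Σ = subst (_≤ Σℚ n f) (Σℚ-1 n)
    (Σℚ-mono-≤ n (λ i → ℚP.≮⇒≥ (λ fi<1 → none (i , fi<1))))

argmax : ∀ n (f : Fin (suc n) → ℚ) → ∃ λ K → ∀ K' → f K' ≤ f K
argmax zero    f = zero , λ { zero → ℚP.≤-refl }
argmax (suc n) f with argmax n (f ∘ suc)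
... | K , max with f zero ℚP.≤? f (suc K)
... | yes f0≤ = suc K , λ { zero → f0≤ ; (suc K') → max K' }
... | no  f0≰ = zero , λ { zero → ℚP.≤-refl
                         ; (suc K') → ℚP.≤-trans (max K') (ℚP.<⇒≤ (ℚP.≰⇒> f0≰)) }

argmin : ∀ n (f : Fin (suc n) → ℚ) → ∃ λ K → ∀ K' → f K ≤ f K'
argmin zero    f = zero , λ { zero → ℚP.≤-refl }
argmin (suc n) f with argmin n (f ∘ suc)
... | K , min with f (suc K) ℚP.≤? f zero
... | yes ≤f0 = suc K , λ { zero → ≤f0 ; (suc K') → min K' }
... | no  ≰f0 = zero , λ { zero → ℚP.≤-refl
                         ; (suc K') → ℚP.≤-trans (ℚP.<⇒≤ (ℚP.≰⇒> ≰f0)) (min K') }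

δ-refl : ∀ {n} (a : Fin n) → δ a a ≡ + 1
δ-refl a with a Fin.≟ a
... | yes _   = refl
... | no  a≢a = ⊥-elim (a≢a refl)

δ-≢ : ∀ {n} {a b : Fin n} → a ≢ b → δ a b ≡ + 0
δ-≢ {a = a} {b} a≢b with a Fin.≟ b
... | yes a≡b = ⊥-elim (a≢b a≡b)
... | no  _   = refl

δ-sym : ∀ {n} (a b : Fin n) → δ a b ≡ δ b a
δ-sym a b with a Fin.≟ b | b Fin.≟ a
... | yes _   | yes _   = refl
... | no  _   | no  _   = refl
... | yes a≡b | no  b≢a = ⊥-elim (b≢a (sym a≡b))
... | no  a≢b | yes b≡a = ⊥-elim (a≢b (sym b≡a))

0≤δ : ∀ {n} (a b : Fin n) → 0ℚ ≤ toℚ (δ a b)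
0≤δ a b with a Fin.≟ b
... | yes _ = 0≤toℚ+ 1
... | no  _ = 0≤toℚ+ 0

Σℚ-δˡ : ∀ n (a : Fin n) (h : Fin n → ℚ) → Σℚ n (λ j → toℚ (δ a j) * h j) ≡ h a
Σℚ-δˡ (suc n) a h = trans
  (Σℚ-supported n (λ j → toℚ (δ a j) * h j) a (λ j →
    trans (cong (λ x → toℚ x * h (punchIn a j)) (δ-≢ (FinP.punchInᵢ≢i a j ∘ sym)))
          (ℚP.*-zeroˡ (h (punchIn a j)))))
  (trans (cong (λ x → toℚ x * h a) (δ-refl a)) (ℚP.*-identityˡ (h a)))

Σℚ-δʳ : ∀ n (a : Fin n) (h : Fin n → ℚ) → Σℚ n (λ j → toℚ (δ j a) * h j) ≡ h a
Σℚ-δʳ n a h = trans (Σℚ-cong n (λ j → cong (λ x → toℚ x * h j) (δ-sym j a))) (Σℚ-δˡ n a h)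

cycPred : ∀ {n} → Fin n → Fin n
cycPred {suc n} zero    = fromℕ n
cycPred {suc n} (suc i) = inject₁ i

toℕ-cycSuc : ∀ {n} (i : Fin (suc n)) → toℕ (cycSuc i) ≡ suc (toℕ i) ℕ.% suc n
toℕ-cycSuc {n} i = FinP.toℕ-fromℕ< (m%n<n (suc (toℕ i)) (suc n))

cycSuc-inject₁ : ∀ {n} (i : Fin n) → cycSuc (inject₁ i) ≡ suc i
cycSuc-inject₁ {n} i = FinP.toℕ-injective (begin
  toℕ (cycSuc (inject₁ i))      ≡⟨ toℕ-cycSuc (inject₁ i) ⟩
  suc (toℕ (inject₁ i)) ℕ.% suc n ≡⟨ cong (λ x → suc x ℕ.% suc n) (FinP.toℕ-inject₁ i) ⟩
  suc (toℕ i) ℕ.% suc n          ≡⟨ m<n⇒m%n≡m (ℕ.s≤s (FinP.toℕ<n i)) ⟩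
  suc (toℕ i)                    ∎)
  where open ≡-Reasoning

cycSuc-fromℕ : ∀ n → cycSuc (fromℕ n) ≡ zero
cycSuc-fromℕ n = FinP.toℕ-injective (begin
  toℕ (cycSuc (fromℕ n))      ≡⟨ toℕ-cycSuc (fromℕ n) ⟩
  suc (toℕ (fromℕ n)) ℕ.% suc n ≡⟨ cong (λ x → suc x ℕ.% suc n) (FinP.toℕ-fromℕ n) ⟩
  suc n ℕ.% suc n              ≡⟨ n%n≡0 (suc n) ⟩
  0                            ∎)
  where open ≡-Reasoning

cycSuc-cycPred : ∀ {n} (i : Fin n) → cycSuc (cycPred i) ≡ i
cycSuc-cycPred {suc n} zero    = cycSuc-fromℕ n
cycSuc-cycPred {suc n} (suc i) = cycSuc-inject₁ i

cycPred-cycSuc : ∀ {n} (i : Fin n) → cycPred (cycSuc i) ≡ i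
cycPred-cycSuc {suc n} i with n ℕ.≟ toℕ i
... | yes n≡i = subst (λ i → cycPred (cycSuc i) ≡ i)
  (FinP.toℕ-injective (trans (FinP.toℕ-fromℕ n) n≡i)) (cong cycPred (cycSuc-fromℕ n))
... | no  n≢i = subst (λ i → cycPred (cycSuc i) ≡ i)
  (FinP.inject₁-lower₁ i n≢i) (cong cycPred (cycSuc-inject₁ (lower₁ i n≢i)))

cycSuc-permutation : ∀ n → Permutation′ n
cycSuc-permutation n = permutation cycSuc cycPred cycSuc-cycPred cycPred-cycSuc

Σℚ-cycSuc : ∀ n (f : Fin n → ℚ) → Σℚ n (f ∘ cycSuc) ≡ Σℚ n f
Σℚ-cycSuc n f = Σℚ-permute n f (cycSuc-permutation n)

Σℚ-cycPred : ∀ n (f : Fin n → ℚ) → Σℚ n (f ∘ cycPred) ≡ Σℚ n f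
Σℚ-cycPred n f =
  trans (sym (Σℚ-cycSuc n (f ∘ cycPred))) (Σℚ-cong n (λ i → cong f (cycPred-cycSuc i)))

δ-cycSuc : ∀ {n} (a b : Fin n) → δ a (cycSuc b) ≡ δ (cycPred a) b
δ-cycSuc a b with a Fin.≟ cycSuc b | cycPred a Fin.≟ b
... | yes _ | yes _ = refl
... | no  _ | no  _ = refl
... | yes a≡b⁺ | no  a⁻≢b = ⊥-elim (a⁻≢b (trans (cong cycPred a≡b⁺) (cycPred-cycSuc b)))
... | no  a≢b⁺ | yes a⁻≡b = ⊥-elim (a≢b⁺ (trans (sym (cycSuc-cycPred a)) (cong cycSuc a⁻≡b)))

-- Induction on a, changing the predicate to P ∘ inject₁: inject₁ a is not a subterm of suc a.
descend-to-zero : ∀ {ℓ} {n} {P : Pred (Fin (suc n)) ℓ} →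
  (∀ i → P (suc i) → P (inject₁ i)) → ∀ a → P a → P zero
descend-to-zero         step zero    Pa = Pa
descend-to-zero {n = suc n} {P} step (suc a) Pa =
  descend-to-zero {P = P ∘ inject₁} (step ∘ inject₁) a (step a Pa)

cycPred-closed : ∀ {ℓ} {n} {P : Pred (Fin n) ℓ} →
  (∀ i → P i → P (cycPred i)) → ∀ a → P a → ∀ b → P b
cycPred-closed {n = suc n} {P} step a Pa =
  >-weakInduction P (step zero (descend-to-zero (step ∘ suc) a Pa)) (step ∘ suc)

Σℚ-weights : ∀ k (ls : Fin k → ℚ) B → Σℚ k ls ≡ 1ℚ → Σℚ k (λ i → ls i * B) ≡ B
Σℚ-weights k ls B Σ≡1 = begin
  Σℚ k (λ i → ls i * B) ≡⟨ Σℚ-cong k (λ i → ℚP.*-comm (ls i) B) ⟩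
  Σℚ k (λ i → B * ls i) ≡⟨ Σℚ-*ˡ k B ls ⟩
  B * Σℚ k ls           ≡⟨ cong (B *_) Σ≡1 ⟩
  B * 1ℚ                ≡⟨ ℚP.*-identityʳ B ⟩
  B                     ∎
  where open ≡-Reasoning

convex-≤ : ∀ k {ls b : Fin k → ℚ} {B} → (∀ i → 0ℚ ≤ ls i) → Σℚ k ls ≡ 1ℚ →
  (∀ i → b i ≤ B) → Σℚ k (λ i → ls i * b i) ≤ B
convex-≤ k {ls} {B = B} 0≤ls Σ≡1 b≤B = ℚP.≤-trans
  (Σℚ-mono-≤ k (λ i → ℚP.*-monoˡ-≤-nonNeg (ls i) {{ℚ.nonNegative (0≤ls i)}} (b≤B i)))
  (ℚP.≤-reflexive (Σℚ-weights k ls B Σ≡1))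

convex-≥ : ∀ k {ls b : Fin k → ℚ} {B} → (∀ i → 0ℚ ≤ ls i) → Σℚ k ls ≡ 1ℚ →
  (∀ i → B ≤ b i) → B ≤ Σℚ k (λ i → ls i * b i)
convex-≥ k {ls} {B = B} 0≤ls Σ≡1 B≤b = ℚP.≤-trans
  (ℚP.≤-reflexive (sym (Σℚ-weights k ls B Σ≡1)))
  (Σℚ-mono-≤ k (λ i → ℚP.*-monoˡ-≤-nonNeg (ls i) {{ℚ.nonNegative (0≤ls i)}} (B≤b i)))

module _ {n k} (pts : Fin k → Ptℤ n) where

  vertex∈conv : ∀ K → InConv pts (embed (pts K))
  vertex∈conv K = (λ i → toℚ (δ K i)) , 0≤δ K ,
    trans (Σℚ-cong k (λ i → sym (ℚP.*-identityʳ _))) (Σℚ-δˡ k K (λ _ → 1ℚ)) ,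
    λ c → sym (Σℚ-δˡ k K (λ i → toℚ (pts i c)))

  ⟪⟫-convex : ∀ (f : Ptℤ n) x (ls : Fin k → ℚ) →
    (∀ c → x c ≡ Σℚ k (λ i → ls i * toℚ (pts i c))) →
    ⟪ f , x ⟫ ≡ Σℚ k (λ i → ls i * ⟪ f , embed (pts i) ⟫)
  ⟪⟫-convex f x ls x≡ = begin
    Σℚ n (λ c → toℚ (f c) * x c)
      ≡⟨ Σℚ-cong n (λ c → cong (toℚ (f c) *_) (x≡ c)) ⟩
    Σℚ n (λ c → toℚ (f c) * Σℚ k (λ i → ls i * toℚ (pts i c)))
      ≡⟨ Σℚ-cong n (λ c → sym (Σℚ-*ˡ k (toℚ (f c)) (λ i → ls i * toℚ (pts i c)))) ⟩
    Σℚ n (λ c → Σℚ k (λ i → toℚ (f c) * (ls i * toℚ (pts i c))))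
      ≡⟨ Σℚ-comm n k _ ⟩
    Σℚ k (λ i → Σℚ n (λ c → toℚ (f c) * (ls i * toℚ (pts i c))))
      ≡⟨ Σℚ-cong k (λ i → trans (Σℚ-cong n (λ c →
           solve 3 (λ a b c → a :* (b :* c) := b :* (a :* c)) refl (toℚ (f c)) (ls i) (toℚ (pts i c))))
           (Σℚ-*ˡ n (ls i) (λ c → toℚ (f c) * toℚ (pts i c)))) ⟩
    Σℚ k (λ i → ls i * ⟪ f , embed (pts i) ⟫) ∎
    where open ≡-Reasoning

  ⟪⟫-≤-on-conv : ∀ f {x B} → InConv pts x →
    (∀ K → ⟪ f , embed (pts K) ⟫ ≤ B) → ⟪ f , x ⟫ ≤ B
  ⟪⟫-≤-on-conv f {x} (ls , 0≤ls , Σ≡1 , x≡) bound =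
    subst (_≤ _) (sym (⟪⟫-convex f x ls x≡)) (convex-≤ k 0≤ls Σ≡1 bound)

  ⟪⟫-≥-on-conv : ∀ f {x B} → InConv pts x →
    (∀ K → B ≤ ⟪ f , embed (pts K) ⟫) → B ≤ ⟪ f , x ⟫
  ⟪⟫-≥-on-conv f {x} (ls , 0≤ls , Σ≡1 , x≡) bound =
    subst (_ ≤_) (sym (⟪⟫-convex f x ls x≡)) (convex-≥ k 0≤ls Σ≡1 bound)

weight-one⇒vertex : ∀ {n k} (pts : Fin (suc k) → Ptℤ n) {z} (z∈ : InConv pts (embed z)) a →
  proj₁ z∈ a ≡ 1ℚ → ∀ c → z c ≡ pts a c
weight-one⇒vertex {k = k} pts {z} (ls , 0≤ls , Σ≡1 , z≡) a lsₐ≡1 c = toℚ-injective (begin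
  toℚ (z c)                       ≡⟨ z≡ c ⟩
  Σℚ (suc k) (λ i → ls i * ptᶜ i)  ≡⟨ Σℚ-supported k (λ i → ls i * ptᶜ i) a others-vanish ⟩
  ls a * ptᶜ a                    ≡⟨ cong (_* ptᶜ a) lsₐ≡1 ⟩
  1ℚ * ptᶜ a                      ≡⟨ ℚP.*-identityˡ (ptᶜ a) ⟩
  ptᶜ a                           ∎)
  where
  open ≡-Reasoning
  ptᶜ : Fin (suc k) → ℚ
  ptᶜ i = toℚ (pts i c)
  others≡0 : ∀ j → ls (punchIn a j) ≡ 0ℚ
  others≡0 = Σℚ≡0⇒≡0 k (0≤ls ∘ punchIn a) (identityʳ-unique 1ℚ (Σℚ k (ls ∘ punchIn a))
    (trans (cong (_+ Σℚ k (ls ∘ punchIn a)) (sym lsₐ≡1)) (trans (sym (Σℚ-remove k ls a)) Σ≡1)))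
  others-vanish : ∀ j → ls (punchIn a j) * ptᶜ (punchIn a j) ≡ 0ℚ
  others-vanish j = trans (cong (_* ptᶜ (punchIn a j)) (others≡0 j)) (ℚP.*-zeroˡ (ptᶜ (punchIn a j)))

⟪⟫-origin : ∀ n (g : Ptℤ n) → ⟪ g , embed (λ _ → + 0) ⟫ ≡ 0ℚ
⟪⟫-origin n g = trans (Σℚ-cong n (λ c → ℚP.*-zeroʳ (toℚ (g c)))) (Σℚ-0 n)

LatticeWidth≥-nonPos : ∀ {n k} (pts : Fin (suc k) → Ptℤ n) {b} → b ≤ 0ℚ → LatticeWidth≥ pts b
LatticeWidth≥-nonPos pts {b} b≤0 f _ = x , x , vertex∈conv pts zero , vertex∈conv pts zero ,
  subst (b ≤_) (sym (ℚP.+-inverseʳ ⟪ f , x ⟫)) b≤0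
  where x = embed (pts zero)

module _ {d} {v : Fin d → Ptℤ d} where

  combination-unique : LinIndep v → ∀ (a b : Fin d → ℚ) →
    (∀ k → Σℚ d (λ i → a i * toℚ (v i k)) ≡ Σℚ d (λ i → b i * toℚ (v i k))) → ∀ i → a i ≡ b i
  combination-unique indep a b a≡b i =
    x∙y⁻¹≈ε⇒x≈y (a i) (b i) (indep (λ i → a i - b i) difference≡0 i)
    where
    difference≡0 : ∀ k → Σℚ d (λ i → (a i - b i) * toℚ (v i k)) ≡ 0ℚ
    difference≡0 k = begin
      Σℚ d (λ i → (a i - b i) * toℚ (v i k))
        ≡⟨ Σℚ-cong d (λ i → solve 3 (λ a b x → (a :- b) :* x := a :* x :+ con (- 1ℚ) :* (b :* x))
             refl (a i) (b i) (toℚ (v i k))) ⟩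
      Σℚ d (λ i → a i * toℚ (v i k) + (- 1ℚ) * (b i * toℚ (v i k)))
        ≡⟨ Σℚ-+ d (λ i → a i * toℚ (v i k)) (λ i → (- 1ℚ) * (b i * toℚ (v i k))) ⟩
      Σℚ d (λ i → a i * toℚ (v i k)) + Σℚ d (λ i → (- 1ℚ) * (b i * toℚ (v i k)))
        ≡⟨ cong₂ _+_ (a≡b k) (Σℚ-*ˡ d (- 1ℚ) _) ⟩
      Σℚ d (λ i → b i * toℚ (v i k)) + (- 1ℚ) * Σℚ d (λ i → b i * toℚ (v i k))
        ≡⟨ solve 1 (λ x → x :+ con (- 1ℚ) :* x := con 0ℚ) refl (Σℚ d (λ i → b i * toℚ (v i k))) ⟩
      0ℚ ∎
      where open ≡-Reasoning

  simplex-conv : ∀ (y : Ptℤ d) (c : Fin d → ℚ) → (∀ i → 0ℚ ≤ c i) → Σℚ d c ≤ 1ℚ →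
    (∀ k → toℚ (y k) ≡ Σℚ d (λ i → c i * toℚ (v i k))) → InConv (simplexVerts v) (embed y)
  simplex-conv y c 0≤c Σ≤1 y≡ = ((1ℚ - Σℚ d c) ∷ c) , 0≤weights ,
    solve 1 (λ t → (con 1ℚ :- t) :+ t := con 1ℚ) refl (Σℚ d c) ,
    λ k → trans (y≡ k) (sym (trans (cong (_+ combination k) (ℚP.*-zeroʳ (1ℚ - Σℚ d c)))
      (ℚP.+-identityˡ (combination k))))
    where
    combination : Fin d → ℚ
    combination k = Σℚ d (λ i → c i * toℚ (v i k))
    0≤weights : ∀ i → 0ℚ ≤ ((1ℚ - Σℚ d c) ∷ c) i
    0≤weights zero    =
      subst (_≤ 1ℚ - Σℚ d c) (ℚP.+-inverseʳ (Σℚ d c)) (ℚP.+-monoˡ-≤ (- Σℚ d c) Σ≤1)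
    0≤weights (suc i) = 0≤c i

  module _ (indep : LinIndep v) (empty : EmptyPolytope (simplexVerts v)) where

    lattice-combination : ∀ (y : Ptℤ d) (c : Fin d → ℚ) → (∀ i → 0ℚ ≤ c i) → Σℚ d c ≤ 1ℚ →
      (∀ k → toℚ (y k) ≡ Σℚ d (λ i → c i * toℚ (v i k))) →
      (∀ i → c i ≡ 0ℚ) ⊎ (∃ λ i₀ → ∀ i → c i ≡ toℚ (δ i₀ i))
    lattice-combination y c 0≤c Σ≤1 y≡ with empty y (simplex-conv y c 0≤c Σ≤1 y≡)
    ... | zero , y≡0 = inj₁ (combination-unique indep c (λ _ → 0ℚ) (λ k → trans (sym (y≡ k))
      (trans (cong toℚ (y≡0 k))
        (sym (trans (Σℚ-cong d (λ i → ℚP.*-zeroˡ (toℚ (v i k)))) (Σℚ-0 d))))))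
    ... | suc i₀ , y≡vᵢ₀ = inj₂ (i₀ , combination-unique indep c (λ i → toℚ (δ i₀ i)) (λ k →
      trans (sym (y≡ k)) (trans (cong toℚ (y≡vᵢ₀ k)) (sym (Σℚ-δˡ d i₀ (λ i → toℚ (v i k)))))))

κ : ℕ → ℚ
κ m = toℚ (+ m ℤ.- + 2)

block : ∀ {m d} → Ptℤ (m ℕ.* d) → Fin m → Ptℤ d
block f j k = f (combine j k)

module _ (m : ℕ) {d} (v : Fin d → Ptℤ d) where

  PmVerts-suc-combine : ∀ j i → PmVerts m v (suc (combine j i)) ≡ wVec m v i j
  PmVerts-suc-combine j i = cong (λ p → wVec m v (proj₂ p) (proj₁ p)) (FinP.remQuot-combine j i)

  *-wVec-entry : ∀ g i j j' k → g * toℚ (wVec m v i j (combine j' k)) ≡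
    toℚ (δ j' j) * (κ m * (g * toℚ (v i k))) + toℚ (δ j' (cycSuc j)) * (g * toℚ (v (cycSuc i) k))
  *-wVec-entry g i j j' k = begin
    g * toℚ (wVec m v i j (combine j' k))
      ≡⟨ cong (λ p → g * toℚ (((+ m ℤ.- + 2) ℤ.* (δ (proj₁ p) j ℤ.* v i (proj₂ p)))
           ℤ.+ (δ (proj₁ p) (cycSuc j) ℤ.* v (cycSuc i) (proj₂ p)))) (FinP.remQuot-combine j' k) ⟩
    g * toℚ ((+ m ℤ.- + 2) ℤ.* (δ j' j ℤ.* v i k) ℤ.+ δ j' (cycSuc j) ℤ.* v (cycSuc i) k)
      ≡⟨ cong (g *_) (trans (toℚ-+ ((+ m ℤ.- + 2) ℤ.* (δ j' j ℤ.* v i k)) (δ j' (cycSuc j) ℤ.* v (cycSuc i) k))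
           (cong₂ _+_ (trans (toℚ-* (+ m ℤ.- + 2) (δ j' j ℤ.* v i k)) (cong (κ m *_) (toℚ-* (δ j' j) (v i k))))
                      (toℚ-* (δ j' (cycSuc j)) (v (cycSuc i) k)))) ⟩
    g * (κ m * (toℚ (δ j' j) * toℚ (v i k)) + toℚ (δ j' (cycSuc j)) * toℚ (v (cycSuc i) k))
      ≡⟨ solve 6 (λ g μ a x b y → g :* (μ :* (a :* x) :+ b :* y) := a :* (μ :* (g :* x)) :+ b :* (g :* y))
           refl g (κ m) (toℚ (δ j' j)) (toℚ (v i k)) (toℚ (δ j' (cycSuc j))) (toℚ (v (cycSuc i) k)) ⟩
    toℚ (δ j' j) * (κ m * (g * toℚ (v i k))) + toℚ (δ j' (cycSuc j)) * (g * toℚ (v (cycSuc i) k)) ∎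
    where open ≡-Reasoning

  ⟪⟫-wVec : ∀ (f : Ptℤ (m ℕ.* d)) i j → ⟪ f , embed (wVec m v i j) ⟫ ≡
    κ m * ⟪ block f j , embed (v i) ⟫ + ⟪ block f (cycSuc j) , embed (v (cycSuc i)) ⟫
  ⟪⟫-wVec f i j = begin
    Σℚ (m ℕ.* d) (λ c → toℚ (f c) * toℚ (wVec m v i j c))
      ≡⟨ Σℚ-combine m d (λ c → toℚ (f c) * toℚ (wVec m v i j c)) ⟩
    Σℚ m (λ j' → Σℚ d (λ k → F j' k * toℚ (wVec m v i j (combine j' k))))
      ≡⟨ Σℚ-cong m on-block ⟩
    Σℚ m (λ j' → toℚ (δ j' j) * (κ m * A j') + toℚ (δ j' (cycSuc j)) * B j')
      ≡⟨ Σℚ-+ m (λ j' → toℚ (δ j' j) * (κ m * A j')) (λ j' → toℚ (δ j' (cycSuc j)) * B j') ⟩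
    Σℚ m (λ j' → toℚ (δ j' j) * (κ m * A j')) + Σℚ m (λ j' → toℚ (δ j' (cycSuc j)) * B j')
      ≡⟨ cong₂ _+_ (Σℚ-δʳ m j (λ j' → κ m * A j')) (Σℚ-δʳ m (cycSuc j) B) ⟩
    κ m * A j + B (cycSuc j) ∎
    where
    open ≡-Reasoning
    F : Fin m → Fin d → ℚ
    F j' k = toℚ (block f j' k)
    A B : Fin m → ℚ
    A j' = ⟪ block f j' , embed (v i) ⟫
    B j' = ⟪ block f j' , embed (v (cycSuc i)) ⟫
    on-block : ∀ j' → Σℚ d (λ k → F j' k * toℚ (wVec m v i j (combine j' k))) ≡
      toℚ (δ j' j) * (κ m * A j') + toℚ (δ j' (cycSuc j)) * B j'
    on-block j' = begin
      Σℚ d (λ k → F j' k * toℚ (wVec m v i j (combine j' k)))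
        ≡⟨ Σℚ-cong d (λ k → *-wVec-entry (F j' k) i j j' k) ⟩
      Σℚ d (λ k → toℚ (δ j' j) * (κ m * (F j' k * toℚ (v i k)))
                  + toℚ (δ j' (cycSuc j)) * (F j' k * toℚ (v (cycSuc i) k)))
        ≡⟨ Σℚ-linear d (toℚ (δ j' j)) (toℚ (δ j' (cycSuc j)))
             (λ k → κ m * (F j' k * toℚ (v i k))) (λ k → F j' k * toℚ (v (cycSuc i) k)) ⟩
      toℚ (δ j' j) * Σℚ d (λ k → κ m * (F j' k * toℚ (v i k))) + toℚ (δ j' (cycSuc j)) * B j'
        ≡⟨ cong (λ x → toℚ (δ j' j) * x + toℚ (δ j' (cycSuc j)) * B j')
             (Σℚ-*ˡ d (κ m) (λ k → F j' k * toℚ (v i k))) ⟩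
      toℚ (δ j' j) * (κ m * A j') + toℚ (δ j' (cycSuc j)) * B j' ∎

  Σ-weighted-wVec : ∀ (G : Fin m → Fin d → ℚ) j' k →
    Σℚ m (λ j → Σℚ d (λ i → G j i * toℚ (wVec m v i j (combine j' k)))) ≡
    Σℚ d (λ i → (κ m * G j' i + G (cycPred j') (cycPred i)) * toℚ (v i k))
  Σ-weighted-wVec G j' k = begin
    Σℚ m (λ j → Σℚ d (λ i → G j i * toℚ (wVec m v i j (combine j' k))))
      ≡⟨ Σℚ-cong m on-block ⟩
    Σℚ m (λ j → toℚ (δ j' j) * X j + toℚ (δ (cycPred j') j) * Y j)
      ≡⟨ Σℚ-+ m (λ j → toℚ (δ j' j) * X j) (λ j → toℚ (δ (cycPred j') j) * Y j) ⟩
    Σℚ m (λ j → toℚ (δ j' j) * X j) + Σℚ m (λ j → toℚ (δ (cycPred j') j) * Y j)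
      ≡⟨ cong₂ _+_ (Σℚ-δˡ m j' X) (Σℚ-δˡ m (cycPred j') Y) ⟩
    X j' + Y (cycPred j')
      ≡⟨ cong (_+_ (X j')) (trans
           (Σℚ-cong d (λ i → cong (λ x → G (cycPred j') x * toℚ (v (cycSuc i) k)) (sym (cycPred-cycSuc i))))
           (Σℚ-cycSuc d (λ i → G (cycPred j') (cycPred i) * toℚ (v i k)))) ⟩
    X j' + Σℚ d (λ i → G (cycPred j') (cycPred i) * toℚ (v i k))
      ≡⟨ sym (Σℚ-+ d (λ i → κ m * (G j' i * toℚ (v i k)))
                     (λ i → G (cycPred j') (cycPred i) * toℚ (v i k))) ⟩
    Σℚ d (λ i → κ m * (G j' i * toℚ (v i k)) + G (cycPred j') (cycPred i) * toℚ (v i k))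
      ≡⟨ Σℚ-cong d (λ i → solve 4 (λ μ a x b → μ :* (a :* x) :+ b :* x := (μ :* a :+ b) :* x)
           refl (κ m) (G j' i) (toℚ (v i k)) (G (cycPred j') (cycPred i))) ⟩
    Σℚ d (λ i → (κ m * G j' i + G (cycPred j') (cycPred i)) * toℚ (v i k)) ∎
    where
    open ≡-Reasoning
    X Y : Fin m → ℚ
    X j = Σℚ d (λ i → κ m * (G j i * toℚ (v i k)))
    Y j = Σℚ d (λ i → G j i * toℚ (v (cycSuc i) k))
    on-block : ∀ j → Σℚ d (λ i → G j i * toℚ (wVec m v i j (combine j' k))) ≡
      toℚ (δ j' j) * X j + toℚ (δ (cycPred j') j) * Y j
    on-block j = begin
      Σℚ d (λ i → G j i * toℚ (wVec m v i j (combine j' k)))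
        ≡⟨ Σℚ-cong d (λ i → *-wVec-entry (G j i) i j j' k) ⟩
      Σℚ d (λ i → toℚ (δ j' j) * (κ m * (G j i * toℚ (v i k)))
                  + toℚ (δ j' (cycSuc j)) * (G j i * toℚ (v (cycSuc i) k)))
        ≡⟨ Σℚ-linear d (toℚ (δ j' j)) (toℚ (δ j' (cycSuc j)))
             (λ i → κ m * (G j i * toℚ (v i k))) (λ i → G j i * toℚ (v (cycSuc i) k)) ⟩
      toℚ (δ j' j) * X j + toℚ (δ j' (cycSuc j)) * Y j
        ≡⟨ cong (λ x → toℚ (δ j' j) * X j + toℚ x * Y j) (δ-cycSuc j' j) ⟩
      toℚ (δ j' j) * X j + toℚ (δ (cycPred j') j) * Y j ∎

module _ {d} (m' : ℕ) {w} (v : Fin d → Ptℤ d) (width-P : LatticeWidth≥ (simplexVerts v) (toℚ (+ w)))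
         (f : Ptℤ (suc (suc (suc m')) ℕ.* d)) where

  private
    m : ℕ
    m = suc (suc (suc m'))

  blockValue : Fin m → Fin (suc d) → ℚ
  blockValue j K = ⟪ block f j , embed (simplexVerts v K) ⟫

  Kmax Kmin : Fin m → Fin (suc d)
  Kmax j = proj₁ (argmax d (blockValue j))
  Kmin j = proj₁ (argmin d (blockValue j))

  spread : Fin m → ℚ
  spread j = blockValue j (Kmax j) - blockValue j (Kmin j)

  blockValue-diff≤spread : ∀ j K K' → blockValue j K - blockValue j K' ≤ spread j
  blockValue-diff≤spread j K K' =
    -‿mono-≤ (proj₂ (argmax d (blockValue j)) K) (proj₂ (argmin d (blockValue j)) K')

  width≤spread : ∀ j → NonZeroFunctional (block f j) → toℚ (+ w) ≤ spread j
  width≤spread j nz with width-P (block f j) nz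
  ... | x , y , x∈ , y∈ , w≤fx-fy = ℚP.≤-trans w≤fx-fy (-‿mono-≤
    (⟪⟫-≤-on-conv (simplexVerts v) (block f j) x∈ (proj₂ (argmax d (blockValue j))))
    (⟪⟫-≥-on-conv (simplexVerts v) (block f j) y∈ (proj₂ (argmin d (blockValue j)))))

  liftVertex : Fin m → Fin (suc d) → Fin (suc (m ℕ.* d))
  liftVertex j zero    = zero
  liftVertex j (suc i) = suc (combine j i)

  shiftVertex : Fin (suc d) → Fin (suc d)
  shiftVertex zero    = zero
  shiftVertex (suc i) = suc (cycSuc i)

  ⟪⟫-liftVertex : ∀ j K → ⟪ f , embed (PmVerts m v (liftVertex j K)) ⟫ ≡
    κ m * blockValue j K + blockValue (cycSuc j) (shiftVertex K)
  ⟪⟫-liftVertex j zero = begin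
    ⟪ f , embed (λ _ → + 0) ⟫  ≡⟨ ⟪⟫-origin (m ℕ.* d) f ⟩
    0ℚ                          ≡⟨ solve 1 (λ μ → con 0ℚ := μ :* con 0ℚ :+ con 0ℚ) refl (κ m) ⟩
    κ m * 0ℚ + 0ℚ               ≡⟨ sym (cong₂ (λ x y → κ m * x + y) (⟪⟫-origin d (block f j))
                                     (⟪⟫-origin d (block f (cycSuc j)))) ⟩
    κ m * blockValue j zero + blockValue (cycSuc j) zero ∎
    where open ≡-Reasoning
  ⟪⟫-liftVertex j (suc i) =
    trans (cong (λ p → ⟪ f , embed p ⟫) (PmVerts-suc-combine m v j i)) (⟪⟫-wVec m v f i j)

  lifted-spread : ∀ j → (∀ j' → spread j' ≤ spread j) →
    toℚ (+ m') * spread j ≤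
    ⟪ f , embed (PmVerts m v (liftVertex j (Kmax j))) ⟫ - ⟪ f , embed (PmVerts m v (liftVertex j (Kmin j))) ⟫
  lifted-spread j spread≤ = begin
    toℚ (+ m') * spread j
      ≡⟨ solve 2 (λ t s → t :* s := (con 1ℚ :+ t) :* s :- s) refl (toℚ (+ m')) (spread j) ⟩
    (1ℚ + toℚ (+ m')) * spread j - spread j
      ≡⟨ cong (λ μ → μ * spread j - spread j) (sym (toℚ-+ (+ 1) (+ m'))) ⟩
    κ m * spread j - spread j
      ≤⟨ ℚP.+-monoʳ-≤ (κ m * spread j) (ℚP.neg-antimono-≤ (ℚP.≤-trans
           (blockValue-diff≤spread (cycSuc j) (shiftVertex (Kmin j)) (shiftVertex (Kmax j)))
           (spread≤ (cycSuc j)))) ⟩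
    κ m * spread j - (b₂ - b₁)
      ≡⟨ solve 5 (λ μ a b x y → μ :* (a :- b) :- (y :- x) := (μ :* a :+ x) :- (μ :* b :+ y))
           refl (κ m) (blockValue j (Kmax j)) (blockValue j (Kmin j)) b₁ b₂ ⟩
    (κ m * blockValue j (Kmax j) + b₁) - (κ m * blockValue j (Kmin j) + b₂)
      ≡⟨ sym (cong₂ _-_ (⟪⟫-liftVertex j (Kmax j)) (⟪⟫-liftVertex j (Kmin j))) ⟩
    ⟪ f , embed (PmVerts m v (liftVertex j (Kmax j))) ⟫ - ⟪ f , embed (PmVerts m v (liftVertex j (Kmin j))) ⟫ ∎
    where
    open ℚP.≤-Reasoning
    b₁ b₂ : ℚ
    b₁ = blockValue (cycSuc j) (shiftVertex (Kmax j))
    b₂ = blockValue (cycSuc j) (shiftVertex (Kmin j))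

  Pm-functional-spread : NonZeroFunctional f →
    ∃ λ x → ∃ λ y → InConv (PmVerts m v) x × InConv (PmVerts m v) y ×
      (toℚ ((+ m ℤ.- + 3) ℤ.* + w) ≤ ⟪ f , x ⟫ - ⟪ f , y ⟫)
  Pm-functional-spread (c , fc≢0) =
    embed (PmVerts m v top) , embed (PmVerts m v bot) ,
    vertex∈conv (PmVerts m v) top , vertex∈conv (PmVerts m v) bot ,
    -- the bound (+ m ℤ.- + 3) ℤ.* + w of the goal reduces to + m' ℤ.* + w
    (begin
      toℚ (+ m' ℤ.* + w)      ≡⟨ toℚ-* (+ m') (+ w) ⟩
      toℚ (+ m') * toℚ (+ w)
        ≤⟨ ℚP.*-monoˡ-≤-nonNeg (toℚ (+ m')) {{ℚ.nonNegative (0≤toℚ+ m')}} w≤spread ⟩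
      toℚ (+ m') * spread j*  ≤⟨ lifted-spread j* spread≤ ⟩
      ⟪ f , embed (PmVerts m v top) ⟫ - ⟪ f , embed (PmVerts m v bot) ⟫ ∎)
    where
    open ℚP.≤-Reasoning
    j* : Fin m
    j* = proj₁ (argmax (suc (suc m')) spread)
    spread≤ : ∀ j → spread j ≤ spread j*
    spread≤ = proj₂ (argmax (suc (suc m')) spread)
    top bot : Fin (suc (m ℕ.* d))
    top = liftVertex j* (Kmax j*)
    bot = liftVertex j* (Kmin j*)
    j₀ : Fin m
    j₀ = proj₁ (remQuot {m} d c)
    block-nonzero : NonZeroFunctional (block f j₀)
    block-nonzero = proj₂ (remQuot {m} d c) ,
      λ eq → fc≢0 (trans (cong f (sym (FinP.combine-remQuot {m} d c))) eq)
    w≤spread : toℚ (+ w) ≤ spread j*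
    w≤spread = ℚP.≤-trans (width≤spread j₀ block-nonzero) (spread≤ j₀)

Pm-width : ∀ {d} m {w} (v : Fin d → Ptℤ d) → LatticeWidth≥ (simplexVerts v) (toℚ (+ w)) → 2 ℕ.≤ m →
  LatticeWidth≥ (PmVerts m v) (toℚ ((+ m ℤ.- + 3) ℤ.* + w))
Pm-width 1 v _ (ℕ.s≤s ())
Pm-width 2 {w} v _ _ = LatticeWidth≥-nonPos (PmVerts 2 v)
  (toℚ-mono-≤ {_} {+ 0} (subst (ℤ._≤ + 0) (sym (ℤP.-1*i≡-i (+ w))) ℤP.neg-≤-pos))
Pm-width (suc (suc (suc m'))) v width-P _ = Pm-functional-spread m' v width-P

module _ {d} (m'' : ℕ) {v : Fin d → Ptℤ d} (indep : LinIndep v) (empty : EmptyPolytope (simplexVerts v))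
         {z : Ptℤ (suc (suc m'') ℕ.* d)} (z∈ : InConv (PmVerts (suc (suc m'')) v) (embed z)) where

  private
    m : ℕ
    m = suc (suc m'')

  weight : Fin (suc (m ℕ.* d)) → ℚ
  weight = proj₁ z∈

  0≤weight : ∀ a → 0ℚ ≤ weight a
  0≤weight = proj₁ (proj₂ z∈)

  Λ : Fin m → Fin d → ℚ
  Λ j i = weight (suc (combine j i))

  0≤Λ : ∀ j i → 0ℚ ≤ Λ j i
  0≤Λ j i = 0≤weight (suc (combine j i))

  -- κ (2 + m'') reduces to toℚ (+ m'').
  0≤κ : 0ℚ ≤ κ m
  0≤κ = 0≤toℚ+ m''

  mass : Fin m → ℚ
  mass j = Σℚ d (Λ j)

  weight₀+Σmass≡1 : weight zero + Σℚ m mass ≡ 1ℚ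
  weight₀+Σmass≡1 = trans (cong (_+_ (weight zero)) (sym (Σℚ-combine m d (weight ∘ suc))))
    (proj₁ (proj₂ (proj₂ z∈)))

  Σmass≤1 : Σℚ m mass ≤ 1ℚ
  Σmass≤1 = subst (Σℚ m mass ≤_) weight₀+Σmass≡1 (q≤p+q (0≤weight zero))

  mass≤1 : ∀ j → mass j ≤ 1ℚ
  mass≤1 j = ℚP.≤-trans (term≤Σℚ m (λ j → Σℚ-nonNeg d (0≤Λ j)) j) Σmass≤1

  coeff : Fin m → Fin d → ℚ
  coeff j i = κ m * Λ j i + Λ (cycPred j) (cycPred i)

  0≤coeff : ∀ j i → 0ℚ ≤ coeff j i
  0≤coeff j i = ℚP.+-mono-≤ (0≤p*q 0≤κ (0≤Λ j i)) (0≤Λ (cycPred j) (cycPred i))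

  Σcoeff : ∀ j → Σℚ d (coeff j) ≡ κ m * mass j + mass (cycPred j)
  Σcoeff j = trans (Σℚ-+ d (λ i → κ m * Λ j i) (λ i → Λ (cycPred j) (cycPred i)))
    (cong₂ _+_ (Σℚ-*ˡ d (κ m) (Λ j)) (Σℚ-cycPred d (Λ (cycPred j))))

  Σcoeff<m : Σℚ m (λ j → Σℚ d (coeff j)) < toℚ (+ m)
  Σcoeff<m = begin-strict
    Σℚ m (λ j → Σℚ d (coeff j))                   ≡⟨ Σℚ-cong m Σcoeff ⟩
    Σℚ m (λ j → κ m * mass j + mass (cycPred j))
      ≡⟨ Σℚ-+ m (λ j → κ m * mass j) (mass ∘ cycPred) ⟩
    Σℚ m (λ j → κ m * mass j) + Σℚ m (mass ∘ cycPred)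
      ≡⟨ cong₂ _+_ (Σℚ-*ˡ m (κ m) mass) (Σℚ-cycPred m mass) ⟩
    κ m * Σℚ m mass + Σℚ m mass
      ≤⟨ ℚP.+-mono-≤ (ℚP.*-monoˡ-≤-nonNeg (κ m) {{ℚ.nonNegative 0≤κ}} Σmass≤1) Σmass≤1 ⟩
    κ m * 1ℚ + 1ℚ
      ≡⟨ solve 1 (λ μ → μ :* con 1ℚ :+ con 1ℚ := con 1ℚ :+ μ) refl (κ m) ⟩
    1ℚ + κ m                                      ≡⟨ sym (toℚ-+ (+ 1) (+ m'')) ⟩
    toℚ (+ suc m'')                               <⟨ toℚ-mono-< (ℤ.+<+ (ℕP.n<1+n (suc m''))) ⟩
    toℚ (+ m)                                     ∎
    where open ℚP.≤-Reasoning

  block-coordinates : ∀ j k → toℚ (block z j k) ≡ Σℚ d (λ i → coeff j i * toℚ (v i k))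
  block-coordinates j k = begin
    toℚ (z (combine j k))
      ≡⟨ proj₂ (proj₂ (proj₂ z∈)) (combine j k) ⟩
    weight zero * 0ℚ + Σℚ (m ℕ.* d) (λ c → weight (suc c) * toℚ (PmVerts m v (suc c) (combine j k)))
      ≡⟨ trans (cong (_+ rest) (ℚP.*-zeroʳ (weight zero))) (ℚP.+-identityˡ rest) ⟩
    Σℚ (m ℕ.* d) (λ c → weight (suc c) * toℚ (PmVerts m v (suc c) (combine j k)))
      ≡⟨ Σℚ-combine m d (λ c → weight (suc c) * toℚ (PmVerts m v (suc c) (combine j k))) ⟩
    Σℚ m (λ j' → Σℚ d (λ i → Λ j' i * toℚ (PmVerts m v (suc (combine j' i)) (combine j k))))
      ≡⟨ Σℚ-cong m (λ j' → Σℚ-cong d (λ i →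
           cong (λ p → Λ j' i * toℚ (p (combine j k))) (PmVerts-suc-combine m v j' i))) ⟩
    Σℚ m (λ j' → Σℚ d (λ i → Λ j' i * toℚ (wVec m v i j' (combine j k))))
      ≡⟨ Σ-weighted-wVec m v Λ j k ⟩
    Σℚ d (λ i → coeff j i * toℚ (v i k)) ∎
    where
    open ≡-Reasoning
    rest : ℚ
    rest = Σℚ (m ℕ.* d) (λ c → weight (suc c) * toℚ (PmVerts m v (suc c) (combine j k)))

  block-lattice : ∀ j → Σℚ d (coeff j) ≤ 1ℚ →
    (∀ i → coeff j i ≡ 0ℚ) ⊎ (∃ λ i₀ → ∀ i → coeff j i ≡ toℚ (δ i₀ i))
  block-lattice j Σ≤1 =
    lattice-combination indep empty (block z j) (coeff j) (0≤coeff j) Σ≤1 (block-coordinates j)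

  Vanishes : Fin m → Set
  Vanishes j = ∀ i → Λ j i ≡ 0ℚ

  coeff-vanishing : ∀ j → Vanishes j → ∀ i → coeff j i ≡ Λ (cycPred j) (cycPred i)
  coeff-vanishing j Λⱼ≡0 i = begin
    κ m * Λ j i + previous ≡⟨ cong (λ x → κ m * x + previous) (Λⱼ≡0 i) ⟩
    κ m * 0ℚ + previous    ≡⟨ cong (_+ previous) (ℚP.*-zeroʳ (κ m)) ⟩
    0ℚ + previous          ≡⟨ ℚP.+-identityˡ previous ⟩
    previous               ∎
    where
    open ≡-Reasoning
    previous : ℚ
    previous = Λ (cycPred j) (cycPred i)

  Σcoeff-vanishing≤1 : ∀ j → Vanishes j → Σℚ d (coeff j) ≤ 1ℚ
  Σcoeff-vanishing≤1 j Λⱼ≡0 = subst (_≤ 1ℚ)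
    (sym (trans (Σℚ-cong d (coeff-vanishing j Λⱼ≡0)) (Σℚ-cycPred d (Λ (cycPred j)))))
    (mass≤1 (cycPred j))

  zero-coeff⇒vanishes : ∀ j → (∀ i → coeff j i ≡ 0ℚ) → Vanishes (cycPred j)
  zero-coeff⇒vanishes j coeff≡0 i = subst (λ i → Λ (cycPred j) i ≡ 0ℚ) (cycPred-cycSuc i)
    (ℚP.≤-antisym (subst (Λ (cycPred j) (cycPred (cycSuc i)) ≤_) (coeff≡0 (cycSuc i))
      (q≤p+q (0≤p*q 0≤κ (0≤Λ j (cycSuc i))))) (0≤Λ (cycPred j) (cycPred (cycSuc i))))

  unit-coeff⇒Σ≡1 : ∀ j i₀ → (∀ i → coeff j i ≡ toℚ (δ i₀ i)) → Σℚ d (coeff j) ≡ 1ℚ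
  unit-coeff⇒Σ≡1 j i₀ coeff≡δ = trans
    (Σℚ-cong d (λ i → trans (coeff≡δ i) (sym (ℚP.*-identityʳ (toℚ (δ i₀ i))))))
    (Σℚ-δˡ d i₀ (λ _ → 1ℚ))

  light-block-vanishes : ∀ j → Σℚ d (coeff j) < 1ℚ → Vanishes (cycPred j)
  light-block-vanishes j Σ<1 =
    [ zero-coeff⇒vanishes j , ⊥-elim ∘ no-unit-coeff ]′ (block-lattice j (ℚP.<⇒≤ Σ<1))
    where
    no-unit-coeff : ¬ (∃ λ i₀ → ∀ i → coeff j i ≡ toℚ (δ i₀ i))
    no-unit-coeff (i₀ , coeff≡δ) = ℚP.<-irrefl (unit-coeff⇒Σ≡1 j i₀ coeff≡δ) Σ<1

  some-block-vanishes : ∃ Vanishes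
  some-block-vanishes =
    map cycPred (λ {j} → light-block-vanishes j) (Σℚ<n⇒∃<1 m (λ j → Σℚ d (coeff j)) Σcoeff<m)

  module _ (no-vertex : ∀ a → weight a ≢ 1ℚ) where

    no-unit-coeff-after-vanishing : ∀ j → Vanishes j →
      ¬ (∃ λ i₀ → ∀ i → coeff j i ≡ toℚ (δ i₀ i))
    no-unit-coeff-after-vanishing j Λⱼ≡0 (i₀ , coeff≡δ) =
      no-vertex (suc (combine (cycPred j) (cycPred i₀)))
        (trans (sym (coeff-vanishing j Λⱼ≡0 i₀)) (trans (coeff≡δ i₀) (cong toℚ (δ-refl i₀))))

    vanishes-cycPred : ∀ j → Vanishes j → Vanishes (cycPred j)
    vanishes-cycPred j Λⱼ≡0 =
      [ zero-coeff⇒vanishes j , ⊥-elim ∘ no-unit-coeff-after-vanishing j Λⱼ≡0 ]′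
        (block-lattice j (Σcoeff-vanishing≤1 j Λⱼ≡0))

    absurd-without-vertex : ⊥
    absurd-without-vertex = no-vertex zero (trans (sym (ℚP.+-identityʳ (weight zero)))
      (trans (cong (_+_ (weight zero)) (sym Σmass≡0)) weight₀+Σmass≡1))
      where
      all-vanish : ∀ j → Vanishes j
      all-vanish =
        cycPred-closed vanishes-cycPred (proj₁ some-block-vanishes) (proj₂ some-block-vanishes)
      Σmass≡0 : Σℚ m mass ≡ 0ℚ
      Σmass≡0 = trans (Σℚ-cong m (λ j → trans (Σℚ-cong d (all-vanish j)) (Σℚ-0 d))) (Σℚ-0 m)

  Pm-lattice-point : ∃ λ K → ∀ c → z c ≡ PmVerts m v K c
  Pm-lattice-point = from-decision (FinP.any? (λ a → weight a ℚP.≟ 1ℚ))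
    where
    from-decision : Dec (∃ λ a → weight a ≡ 1ℚ) → ∃ λ K → ∀ c → z c ≡ PmVerts m v K c
    from-decision (yes (a , wₐ≡1)) = a , weight-one⇒vertex (PmVerts m v) z∈ a wₐ≡1
    from-decision (no  none)       = ⊥-elim (absurd-without-vertex (λ a wₐ≡1 → none (a , wₐ≡1)))

Pm-empty : ∀ {d} m {v : Fin d → Ptℤ d} → LinIndep v → EmptyPolytope (simplexVerts v) → 2 ℕ.≤ m →
  EmptyPolytope (PmVerts m v)
Pm-empty 1 _ _ (ℕ.s≤s ())
Pm-empty (suc (suc m'')) indep empty _ z z∈ = Pm-lattice-point m'' indep empty z∈

lemma8p1 : (d m w : ℕ) (v : Fin d → Ptℤ d) →
    LinIndep v → EmptyPolytope (simplexVerts v) →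
    LatticeWidth≡ (simplexVerts v) (toℚ (+ w)) → 2 ℕ.≤ m →
    LatticeWidth≥ (PmVerts m v) (toℚ ((+ m ℤ.- + 3) ℤ.* + w))
    × EmptyPolytope (PmVerts m v)
lemma8p1 d m w v indep empty (width-P , _) 2≤m =
  Pm-width m v width-P 2≤m , Pm-empty m indep empty 2≤m
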